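{- Let $G=K_{n_1,n_2,\dots,n_t}$ be a complete $t$-partite graph with $n_1\le n_2\le\cdots\le n_t$, and let $k\ge 3$ be an integer with $k\le \sum_{i=1}^t n_i$. (1) If $k\ge t$, then $\tau_k(G)\le \left\lfloor \frac{\sum_{i=1}^t n_i-k}{2}\right\rfloor$. (2) If $k<t$, then $\tau_k(G)\le \sum_{i=k+1}^t n_i+\left\lfloor \frac{\sum_{i=1}^k n_i-k}{2}\right\rfloor$. Moreover, these upper bounds are sharp (attained by some complete multipartite graphs).
   Context: All graphs are finite, simple and undirected. For $S\subseteq V(G)$ with $|S|\ge 2$, a pedant $S$-Steiner tree is a subgraph of $G$ that is a tree containing $S$ in which every vertex of $S$ has degree exactly one. Two pedant $S$-Steiner trees $T,T'$ are internally disjoint if $E(T)\cap E(T')=\emptyset$ and $V(T)\cap V(T')=S$. $\tau_G(S)$ is the maximum number of pairwise internally disjoint pedant $S$-Steiner trees in $G$, and for $2\le k\le |V(G)|$, $\tau_k(G)=\min\{\tau_G(S): S\subseteq V(G),\ |S|=k\}$. -}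

module Defs where

open import Data.Nat using (ℕ; zero; suc; _+_; _∸_; _≤_; _<_; _<ᵇ_)
open import Data.Nat.DivMod using (_/_)
open import Data.Bool using (Bool; true; false; if_then_else_)
open import Data.Fin using (Fin; toℕ; inject₁; fromℕ) renaming (zero to fzero; suc to fsuc)
open import Data.Fin.Subset using (Subset; _∈_; ∣_∣)
open import Data.Vec using (tabulate)
open import Data.List using () renaming (tabulate to ltabulate)
open import Data.Nat.ListAction using (sum)
open import Data.Product using (Σ; _×_; ∃)
open import Relation.Binary.PropositionalEquality using (_≡_; _≢_)
open import Relation.Nullary using (¬_)
open import Relation.Nullary.Decidable using (⌊_⌋)
open import Function.Definitions using (Injective)
open import Data.Fin using (_≟_)

-- Graphs on the vertex set Fin N, given by an adjacency relation.
-- Subgraphs: a vertex set W and an edge set given by a Bool-valued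
-- (symmetric) edge indicator E.

EdgeSet : ℕ → Set
EdgeSet N = Fin N → Fin N → Bool

data Walk {N : ℕ} (E : EdgeSet N) : Fin N → Fin N → Set where
  here : ∀ {u} → Walk E u u
  step : ∀ {u w v} → E u w ≡ true → Walk E w v → Walk E u v

record Cycle {N : ℕ} (E : EdgeSet N) : Set where
  field
    m     : ℕ
    x     : Fin (suc (suc (suc m))) → Fin N
    inj   : Injective _≡_ _≡_ x
    edges : ∀ (i : Fin (suc (suc m))) → E (x (inject₁ i)) (x (fsuc i)) ≡ true
    close : E (x (fromℕ (suc (suc m)))) (x fzero) ≡ true

deg : ∀ {N} → EdgeSet N → Fin N → ℕ
deg E v = ∣ tabulate (E v) ∣

record IsTree {N : ℕ} (Adj : Fin N → Fin N → Set)
              (W : Subset N) (E : EdgeSet N) : Set where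
  field
    esym      : ∀ u v → E u v ≡ E v u
    eInG      : ∀ u v → E u v ≡ true → (u ∈ W) × (v ∈ W) × Adj u v
    connected : ∀ u v → u ∈ W → v ∈ W → Walk E u v
    acyclic   : ¬ Cycle E

record PedantSteinerTree {N : ℕ} (Adj : Fin N → Fin N → Set)
                         (S : Subset N) : Set where
  field
    W      : Subset N
    E      : EdgeSet N
    tree   : IsTree Adj W E
    SinW   : ∀ v → v ∈ S → v ∈ W
    degS   : ∀ v → v ∈ S → deg E v ≡ 1
open PedantSteinerTree public

InternallyDisjoint : ∀ {N} {Adj : Fin N → Fin N → Set} {S : Subset N} →
                     PedantSteinerTree Adj S → PedantSteinerTree Adj S → Set
InternallyDisjoint {S = S} T T' =
  (∀ u v → E T u v ≡ true → E T' u v ≡ false) ×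
  (∀ v → v ∈ W T → v ∈ W T' → v ∈ S)

record DisjointFamily {N : ℕ} (Adj : Fin N → Fin N → Set)
                      (S : Subset N) (m : ℕ) : Set where
  field
    trees    : Fin m → PedantSteinerTree Adj S
    disjoint : ∀ i j → i ≢ j → InternallyDisjoint (trees i) (trees j)

IsTau : ∀ {N} → (Fin N → Fin N → Set) → Subset N → ℕ → Set
IsTau Adj S m = DisjointFamily Adj S m × (∀ m' → DisjointFamily Adj S m' → m' ≤ m)

IsTauK : ∀ {N} → (Fin N → Fin N → Set) → ℕ → ℕ → Set
IsTauK {N} Adj k m =
  (Σ (Subset N) λ S → (∣ S ∣ ≡ k) × IsTau Adj S m) ×
  (∀ (S : Subset N) → ∣ S ∣ ≡ k → ∀ m' → IsTau Adj S m' → m ≤ m')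

-- Complete t-partite graph K_{n_1,…,n_t} on Fin N: p assigns each
-- vertex its part; part i has exactly ns i ≥ 1 vertices; two vertices
-- are adjacent iff they lie in different parts.

KAdj : ∀ {N t} → (Fin N → Fin t) → Fin N → Fin N → Set
KAdj p u v = p u ≢ p v

record IsCompleteMultipartite (N t : ℕ) (ns : Fin t → ℕ)
                              (p : Fin N → Fin t) : Set where
  field
    partSize : ∀ i → ∣ tabulate (λ v → ⌊ p v ≟ i ⌋) ∣ ≡ ns i
    nonempty : ∀ i → 1 ≤ ns i
    sorted   : ∀ i j → toℕ i ≤ toℕ j → ns i ≤ ns j

-- Σ_{i=1}^{k} n_i  and  Σ_{i=k+1}^{t} n_i  (1-based indices i ↔ Fin index i-1)
sumUpTo : ∀ {t} → (Fin t → ℕ) → ℕ → ℕ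
sumUpTo ns k = sum (ltabulate (λ i → if toℕ i <ᵇ k then ns i else 0))

sumFrom : ∀ {t} → (Fin t → ℕ) → ℕ → ℕ
sumFrom ns k = sum (ltabulate (λ i → if toℕ i <ᵇ k then 0 else ns i))

bound1 : ∀ {t} → (Fin t → ℕ) → ℕ → ℕ
bound1 ns k = (sumFrom ns 0 ∸ k) / 2

bound2 : ∀ {t} → (Fin t → ℕ) → ℕ → ℕ
bound2 ns k = sumFrom ns k + (sumUpTo ns k ∸ k) / 2

module Submission where

-- Let S be a set of k ≥ 3 terminals.  In a pedant S-Steiner tree every
-- terminal is a leaf whose neighbour lies outside S (two adjacent leaves
-- would form a whole component).  Let L contain every vertex whose part has
-- no terminal.  Each tree then owns two points of the disjoint union
-- (V ∖ S) ⊔ L: both copies of the neighbour a of a terminal if a ∈ L, and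
-- otherwise a together with the neighbour b of a terminal in the part of a.
-- Internally disjoint trees own disjoint points, so 2 τ_G(S) ≤ (N - k) + |L|
-- (TreeCount).  For t ≤ k we take S meeting every part and L = ∅; for k < t
-- one vertex in each of the first k parts and L the last t - k parts.  Since
-- τ_k(G) ≤ τ_G(S) (τk-upper) this gives both bounds; K_{1,1,1} and
-- K_{1,1,1,1} with k = 3 show they are attained (τk-exact, using stars).

open import Defs
open import Data.Bool using (Bool; true; false; if_then_else_)
open import Data.Bool.Properties using (T-≡)
open import Data.Fin using (Fin; toℕ; inject≤; fromℕ<; _↑ˡ_; _↑ʳ_; splitAt; remQuot; combine)
  renaming (zero to fzero; suc to fsuc)
open import Data.Fin.Properties
  using (suc-injective; 0≢1+n; _≟_; combine-remQuot; toℕ-inject≤; inject≤-injective; toℕ-fromℕ<;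
         toℕ-injective; toℕ<n; splitAt-↑ˡ; splitAt-↑ʳ; ↑ˡ-injective)
open import Data.Fin.Subset using (Subset; ∣_∣; _∈_; _∉_; _⊆_; _∪_; ⁅_⁆; _-_; ⊥; ⊤; outside; inside; ∁)
open import Data.Fin.Subset.Properties
  using (nonempty?; Empty-unique; ∣⊥∣≡0; x∈p⇒∣p-x∣<∣p∣; x∈p∧x≢y⇒x∈p-y; ∣⁅x⁆∣≡1; x∈⁅x⁆; x∈⁅y⁆⇒x≡y;
         p⊆q⇒∣p∣≤∣q∣; x∈p∪q⁺; x∈p∪q⁻; ⊆⊤; ∣⊤∣≡n; in⊆in; out⊆; _∈?_; x∉p⇒x∈∁p; x∉∁p⇒x∈p; x∈∁p⇒x∉p;
         ∣∁p∣≡n∸∣p∣)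
open import Data.List using () renaming (tabulate to ltabulate)
open import Data.List.Properties using (tabulate-cong)
open import Data.Nat using (ℕ; zero; suc; _+_; _∸_; _*_; _≤_; _<_; z≤n; s≤s; _<ᵇ_; _≤?_)
open import Data.Nat.DivMod using (_/_; m*n/n≡m; /-monoˡ-≤; +-distrib-/-∣ˡ)
open import Data.Nat.Divisibility using (divides-refl)
open import Data.Nat.ListAction using (sum)
open import Data.Nat.Properties
  using (≤-refl; ≤-reflexive; ≤-trans; ≤-antisym; ≤-<-trans; <-irrefl; ≤⇒≯; ≰⇒>; <⇒≤; ≤∧≢⇒<; m<1+n⇒m≤n;
         n≤1+n; +-suc; +-identityʳ; +-mono-≤; +-monoʳ-≤; +-∸-comm; m+n∸m≡n; m<n⇒0<n∸m;
         <ᵇ⇒<; <⇒<ᵇ; +-commutativeSemigroup; module ≤-Reasoning)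
open import Algebra.Properties.CommutativeSemigroup +-commutativeSemigroup using (interchange)
open import Data.Nat.Tactic.RingSolver using (solve-∀)
open import Data.Product using (Σ; _×_; _,_; proj₁; proj₂; uncurry)
open import Data.Sum using (_⊎_; inj₁; inj₂; [_,_]′; swap)
open import Data.Vec using (tabulate; _∷_; []; _++_)
open import Data.Vec.Properties using ([]=⇒lookup; lookup⇒[]=; lookup∘tabulate; lookup-++ˡ; lookup-++ʳ)
open import Function using (_∘_; id)
open import Function.Bundles using (Equivalence; mk⇔; _⇔_)
open import Function.Definitions using (Injective)
open import Relation.Binary.PropositionalEquality
open import Relation.Nullary using (¬_; Dec; yes; no; contradiction; ¬¬-excluded-middle)
open import Relation.Nullary.Decidable
  using (⌊_⌋; decidable-stable; dec-true; does-⇔; isYes≗does; _×-dec_; _⊎-dec_)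

⌊⌋-sound : ∀ {P : Set} (d : Dec P) → ⌊ d ⌋ ≡ true → P
⌊⌋-sound (yes p) _ = p

⌊⌋-complete : ∀ {P : Set} (d : Dec P) → P → ⌊ d ⌋ ≡ true
⌊⌋-complete d p = trans (isYes≗does d) (dec-true d p)

⌊⌋-⇔ : ∀ {P Q : Set} → P ⇔ Q → (p? : Dec P) (q? : Dec Q) → ⌊ p? ⌋ ≡ ⌊ q? ⌋
⌊⌋-⇔ P⇔Q p? q? = trans (isYes≗does p?) (trans (does-⇔ P⇔Q p? q?) (sym (isYes≗does q?)))

<ᵇ-true⇒< : ∀ m n → (m <ᵇ n) ≡ true → m < n
<ᵇ-true⇒< m n eq = <ᵇ⇒< m n (Equivalence.from T-≡ eq)

<⇒<ᵇ-true : ∀ {m n} → m < n → (m <ᵇ n) ≡ true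
<⇒<ᵇ-true m<n = Equivalence.to T-≡ (<⇒<ᵇ m<n)

+-twice : ∀ c b → c + b + b ≡ b * 2 + c
+-twice = solve-∀

half : ∀ m X → m * 2 ≤ X → m ≤ X / 2
half m X m*2≤X = subst (_≤ X / 2) (m*n/n≡m m 2) (/-monoˡ-≤ 2 m*2≤X)

member : ∀ {N} (P : Subset N) → 1 ≤ ∣ P ∣ → Σ (Fin N) (_∈ P)
member {N} P 1≤∣P∣ with nonempty? P
... | yes P≠∅ = P≠∅
... | no  P=∅ = contradiction (subst (1 ≤_) ∣P∣≡0 1≤∣P∣) λ ()
  where
  ∣P∣≡0 : ∣ P ∣ ≡ 0
  ∣P∣≡0 = trans (cong ∣_∣ (Empty-unique P=∅)) (∣⊥∣≡0 N)

∈⇒1≤∣∣ : ∀ {N} {P : Subset N} {x} → x ∈ P → 1 ≤ ∣ P ∣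
∈⇒1≤∣∣ {P = P} {x} x∈P = subst (_≤ ∣ P ∣) (∣⁅x⁆∣≡1 x) (p⊆q⇒∣p∣≤∣q∣ ⁅x⁆⊆P)
  where
  ⁅x⁆⊆P : ⁅ x ⁆ ⊆ P
  ⁅x⁆⊆P y∈⁅x⁆ = subst (_∈ P) (sym (x∈⁅y⁆⇒x≡y x y∈⁅x⁆)) x∈P

-- An injection from Fin n into P shows n ≤ ∣ P ∣: the images of 1,…,n-1
-- lie in P minus the image of 0, which is strictly smaller than P.
injection⇒≤∣∣ : ∀ {n N} (P : Subset N) (g : Fin n → Fin N) →
                Injective _≡_ _≡_ g → (∀ i → g i ∈ P) → n ≤ ∣ P ∣
injection⇒≤∣∣ {zero}  P g g-inj g∈P = z≤n
injection⇒≤∣∣ {suc n} P g g-inj g∈P =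
  ≤-<-trans (injection⇒≤∣∣ (P - g fzero) (g ∘ fsuc) (suc-injective ∘ g-inj) tail∈)
            (x∈p⇒∣p-x∣<∣p∣ (g∈P fzero))
  where
  tail∈ : ∀ i → g (fsuc i) ∈ P - g fzero
  tail∈ i = x∈p∧x≢y⇒x∈p-y (g∈P (fsuc i)) (λ eq → 0≢1+n (sym (g-inj eq)))

size-one-unique : ∀ {N} (P : Subset N) → ∣ P ∣ ≡ 1 → ∀ {x y} → x ∈ P → y ∈ P → y ≡ x
size-one-unique P ∣P∣≡1 {x} {y} x∈P y∈P with y ≟ x
... | yes y≡x = y≡x
... | no  y≢x = contradiction (subst (1 <_) ∣P∣≡1 (≤-<-trans 1≤∣P-x∣ (x∈p⇒∣p-x∣<∣p∣ x∈P))) (<-irrefl refl)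
  where
  1≤∣P-x∣ : 1 ≤ ∣ P - x ∣
  1≤∣P-x∣ = ∈⇒1≤∣∣ (x∈p∧x≢y⇒x∈p-y y∈P y≢x)

only-member⇒size-one : ∀ {N} (P : Subset N) w → w ∈ P → (∀ {v} → v ∈ P → v ≡ w) → ∣ P ∣ ≡ 1
only-member⇒size-one P w w∈P only = ≤-antisym ∣P∣≤1 (∈⇒1≤∣∣ w∈P)
  where
  ∣P∣≤1 : ∣ P ∣ ≤ 1
  ∣P∣≤1 = subst (∣ P ∣ ≤_) (∣⁅x⁆∣≡1 w) (p⊆q⇒∣p∣≤∣q∣ (λ v∈P → subst (_∈ ⁅ w ⁆) (sym (only v∈P)) (x∈⁅x⁆ w)))

∣p∪q∣≤∣p∣+∣q∣ : ∀ {n} (p q : Subset n) → ∣ p ∪ q ∣ ≤ ∣ p ∣ + ∣ q ∣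
∣p∪q∣≤∣p∣+∣q∣ []            []            = z≤n
∣p∪q∣≤∣p∣+∣q∣ (outside ∷ p) (outside ∷ q) = ∣p∪q∣≤∣p∣+∣q∣ p q
∣p∪q∣≤∣p∣+∣q∣ (outside ∷ p) (inside  ∷ q) = subst (∣ p ∪ q ∣ <_) (sym (+-suc ∣ p ∣ ∣ q ∣)) (s≤s (∣p∪q∣≤∣p∣+∣q∣ p q))
∣p∪q∣≤∣p∣+∣q∣ (inside  ∷ p) (outside ∷ q) = s≤s (∣p∪q∣≤∣p∣+∣q∣ p q)
∣p∪q∣≤∣p∣+∣q∣ (inside  ∷ p) (inside  ∷ q) = s≤s (≤-trans (∣p∪q∣≤∣p∣+∣q∣ p q) (+-monoʳ-≤ ∣ p ∣ (n≤1+n ∣ q ∣)))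

⊆pair⇒∣∣≤2 : ∀ {N} (P : Subset N) a b → (∀ {x} → x ∈ P → x ≡ a ⊎ x ≡ b) → ∣ P ∣ ≤ 2
⊆pair⇒∣∣≤2 P a b a-or-b = begin
  ∣ P ∣                   ≤⟨ p⊆q⇒∣p∣≤∣q∣ P⊆ab ⟩
  ∣ ⁅ a ⁆ ∪ ⁅ b ⁆ ∣       ≤⟨ ∣p∪q∣≤∣p∣+∣q∣ ⁅ a ⁆ ⁅ b ⁆ ⟩
  ∣ ⁅ a ⁆ ∣ + ∣ ⁅ b ⁆ ∣   ≡⟨ cong₂ _+_ (∣⁅x⁆∣≡1 a) (∣⁅x⁆∣≡1 b) ⟩
  2                       ∎
  where
  open ≤-Reasoning
  P⊆ab : P ⊆ ⁅ a ⁆ ∪ ⁅ b ⁆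
  P⊆ab x∈P with a-or-b x∈P
  ... | inj₁ refl = x∈p∪q⁺ (inj₁ (x∈⁅x⁆ a))
  ... | inj₂ refl = x∈p∪q⁺ (inj₂ (x∈⁅x⁆ b))

image : ∀ {n N} → (Fin n → Fin N) → Subset N
image {zero}  f = ⊥
image {suc n} f = ⁅ f fzero ⁆ ∪ image (f ∘ fsuc)

∈-image : ∀ {n N} (f : Fin n → Fin N) i → f i ∈ image f
∈-image f fzero    = x∈p∪q⁺ (inj₁ (x∈⁅x⁆ (f fzero)))
∈-image f (fsuc i) = x∈p∪q⁺ (inj₂ (∈-image (f ∘ fsuc) i))

∣image∣≤ : ∀ {n N} (f : Fin n → Fin N) → ∣ image f ∣ ≤ n
∣image∣≤ {zero} {N} f = ≤-reflexive (∣⊥∣≡0 N)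
∣image∣≤ {suc n} f = ≤-trans (∣p∪q∣≤∣p∣+∣q∣ ⁅ f fzero ⁆ (image (f ∘ fsuc)))
                             (+-mono-≤ (≤-reflexive (∣⁅x⁆∣≡1 (f fzero))) (∣image∣≤ (f ∘ fsuc)))

extend : ∀ {N} (R : Subset N) k → ∣ R ∣ ≤ k → k ≤ N → Σ (Subset N) λ S → R ⊆ S × ∣ S ∣ ≡ k
extend []            zero    _ _ = [] , (λ x∈ → x∈) , refl
extend (inside ∷ R)  (suc k) (s≤s ∣R∣≤k) (s≤s k≤N) with extend R k ∣R∣≤k k≤N
... | S , R⊆S , ∣S∣≡k = inside ∷ S , in⊆in R⊆S , cong suc ∣S∣≡k
extend {suc N} (outside ∷ R) k ∣R∣≤k k≤1+N with k ≤? N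
... | yes k≤N with extend R k ∣R∣≤k k≤N
...   | S , R⊆S , ∣S∣≡k = outside ∷ S , out⊆ R⊆S , ∣S∣≡k
extend {suc N} (outside ∷ R) k ∣R∣≤k k≤1+N | no k≰N = ⊤ , ⊆⊤ , trans (∣⊤∣≡n (suc N)) (sym (≤-antisym k≤1+N (≰⇒> k≰N)))

∈-tabulate⁺ : ∀ {N} (f : Fin N → Bool) {x} → f x ≡ true → x ∈ tabulate f
∈-tabulate⁺ f {x} fx≡true = lookup⇒[]= x (tabulate f) (trans (lookup∘tabulate f x) fx≡true)

∈-tabulate⁻ : ∀ {N} (f : Fin N → Bool) {x} → x ∈ tabulate f → f x ≡ true
∈-tabulate⁻ f {x} x∈ = trans (sym (lookup∘tabulate f x)) ([]=⇒lookup x∈)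

∣all∣ : ∀ N → ∣ tabulate {n = N} (λ _ → true) ∣ ≡ N
∣all∣ zero    = refl
∣all∣ (suc N) = cong suc (∣all∣ N)

∣p++q∣ : ∀ {m n} (p : Subset m) (q : Subset n) → ∣ p ++ q ∣ ≡ ∣ p ∣ + ∣ q ∣
∣p++q∣ []            q = refl
∣p++q∣ (inside  ∷ p) q = cong suc (∣p++q∣ p q)
∣p++q∣ (outside ∷ p) q = ∣p++q∣ p q

∈-++ˡ : ∀ {m n} {p : Subset m} (q : Subset n) {x} → x ∈ p → x ↑ˡ n ∈ p ++ q
∈-++ˡ {p = p} q {x} x∈p = lookup⇒[]= (x ↑ˡ _) (p ++ q) (trans (lookup-++ˡ p q x) ([]=⇒lookup x∈p))

∈-++ʳ : ∀ {m n} (p : Subset m) {q : Subset n} {x} → x ∈ q → m ↑ʳ x ∈ p ++ q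
∈-++ʳ p {q} {x} x∈q = lookup⇒[]= (_ ↑ʳ x) (p ++ q) (trans (lookup-++ʳ p q x) ([]=⇒lookup x∈q))

𝟙 : Bool → ℕ
𝟙 true  = 1
𝟙 false = 0

∣tabulate∣-suc : ∀ {N} (f : Fin (suc N) → Bool) → ∣ tabulate f ∣ ≡ 𝟙 (f fzero) + ∣ tabulate (f ∘ fsuc) ∣
∣tabulate∣-suc f with f fzero
... | true  = refl
... | false = refl

∑ : ∀ {t} → (Fin t → ℕ) → ℕ
∑ h = sum (ltabulate h)

∑-cong : ∀ {t} {f g : Fin t → ℕ} → (∀ i → f i ≡ g i) → ∑ f ≡ ∑ g
∑-cong f≗g = cong sum (tabulate-cong f≗g)

∑-+ : ∀ {t} (f g : Fin t → ℕ) → ∑ (λ i → f i + g i) ≡ ∑ f + ∑ g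
∑-+ {zero}  f g = refl
∑-+ {suc t} f g = trans (cong (f fzero + g fzero +_) (∑-+ (f ∘ fsuc) (g ∘ fsuc)))
                        (interchange (f fzero) (g fzero) (∑ (f ∘ fsuc)) (∑ (g ∘ fsuc)))

if-0 : ∀ b → (if b then 0 else 0) ≡ 0
if-0 true  = refl
if-0 false = refl

if-+ : ∀ b x y → (if b then x + y else 0) ≡ (if b then x else 0) + (if b then y else 0)
if-+ true  x y = refl
if-+ false x y = refl

∑-0 : ∀ {t} (Q : Fin t → Bool) → ∑ (λ i → if Q i then 0 else 0) ≡ 0
∑-0 {zero}  Q = refl
∑-0 {suc t} Q = cong₂ _+_ (if-0 (Q fzero)) (∑-0 (Q ∘ fsuc))

∑-indicator : ∀ {t} (Q : Fin t → Bool) j → ∑ (λ i → if Q i then 𝟙 ⌊ j ≟ i ⌋ else 0) ≡ 𝟙 (Q j)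
∑-indicator Q fzero = trans (cong₂ _+_ (head (Q fzero)) (∑-0 (Q ∘ fsuc))) (+-identityʳ _)
  where
  head : ∀ b → (if b then 1 else 0) ≡ 𝟙 b
  head true  = refl
  head false = refl
∑-indicator Q (fsuc j) = cong₂ _+_ (if-0 (Q fzero))
  (trans (∑-cong (λ i → cong (λ b → if Q (fsuc i) then 𝟙 b else 0) (≟-suc j i))) (∑-indicator (Q ∘ fsuc) j))
  where
  ≟-suc : ∀ {t} (j i : Fin t) → ⌊ fsuc j ≟ fsuc i ⌋ ≡ ⌊ j ≟ i ⌋
  ≟-suc j i with j ≟ i
  ... | yes _ = refl
  ... | no  _ = refl

fibre-decomposition : ∀ {N t} (p : Fin N → Fin t) (Q : Fin t → Bool) →
  ∣ tabulate (Q ∘ p) ∣ ≡ ∑ (λ i → if Q i then ∣ tabulate (λ v → ⌊ p v ≟ i ⌋) ∣ else 0)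
fibre-decomposition {zero}  p Q = sym (∑-0 Q)
fibre-decomposition {suc N} p Q = begin
  ∣ tabulate (Q ∘ p) ∣
    ≡⟨ ∣tabulate∣-suc (Q ∘ p) ⟩
  𝟙 (Q (p fzero)) + ∣ tabulate (Q ∘ p ∘ fsuc) ∣
    ≡⟨ cong₂ _+_ (sym (∑-indicator Q (p fzero))) (fibre-decomposition (p ∘ fsuc) Q) ⟩
  ∑ first + ∑ rest
    ≡⟨ sym (∑-+ first rest) ⟩
  ∑ (λ i → first i + rest i)
    ≡⟨ ∑-cong (λ i → sym (if-+ (Q i) _ _)) ⟩
  ∑ (λ i → if Q i then 𝟙 ⌊ p fzero ≟ i ⌋ + ∣ tabulate (λ v → ⌊ p (fsuc v) ≟ i ⌋) ∣ else 0)
    ≡⟨ ∑-cong (λ i → cong (if Q i then_else 0) (sym (∣tabulate∣-suc (λ v → ⌊ p v ≟ i ⌋)))) ⟩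
  ∑ (λ i → if Q i then ∣ tabulate (λ v → ⌊ p v ≟ i ⌋) ∣ else 0) ∎
  where
  open ≡-Reasoning
  first rest : Fin _ → ℕ
  first i = if Q i then 𝟙 ⌊ p fzero ≟ i ⌋ else 0
  rest  i = if Q i then ∣ tabulate (λ v → ⌊ p (fsuc v) ≟ i ⌋) ∣ else 0

∑-split : ∀ {t} (ns : Fin t → ℕ) k → sumUpTo ns k + sumFrom ns k ≡ sumFrom ns 0
∑-split ns k = trans (sym (∑-+ (λ i → if toℕ i <ᵇ k then ns i else 0) (λ i → if toℕ i <ᵇ k then 0 else ns i)))
                     (∑-cong λ i → recombine (toℕ i <ᵇ k) (ns i))
  where
  recombine : ∀ b x → (if b then x else 0) + (if b then 0 else x) ≡ x
  recombine true  x = +-identityʳ x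
  recombine false x = refl

walk-++ : ∀ {N} {E : EdgeSet N} {a b c} → Walk E a b → Walk E b c → Walk E a c
walk-++ here         walk′ = walk′
walk-++ (step e walk) walk′ = step e (walk-++ walk walk′)

walk-confined : ∀ {N} (E : EdgeSet N) s u →
                (∀ w → E s w ≡ true → w ≡ u) → (∀ w → E u w ≡ true → w ≡ s) →
                ∀ {x y} → Walk E x y → x ≡ s ⊎ x ≡ u → y ≡ s ⊎ y ≡ u
walk-confined E s u s→u u→s here                     x∈su        = x∈su
walk-confined E s u s→u u→s (step {w = w} e walk) (inj₁ refl) = walk-confined E s u s→u u→s walk (inj₂ (s→u w e))
walk-confined E s u s→u u→s (step {w = w} e walk) (inj₂ refl) = walk-confined E s u s→u u→s walk (inj₁ (u→s w e))

-- In a pedant S-Steiner tree every vertex of S is a leaf; when |S| ≥ 3 its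
-- neighbour lies outside S, for otherwise that neighbour is a leaf as well
-- and the two would form a whole component, leaving no room for a third
-- vertex of S.
module PedantTree {N : ℕ} {Adj : Fin N → Fin N → Set} {S : Subset N}
                  (T : PedantSteinerTree Adj S) where
  open IsTree (tree T)

  neighbour : ∀ {s} → s ∈ S → Σ (Fin N) λ u → E T s u ≡ true
  neighbour {s} s∈S with member (tabulate (E T s)) (≤-reflexive (sym (degS T s s∈S)))
  ... | u , u∈ = u , ∈-tabulate⁻ (E T s) u∈

  unique-neighbour : ∀ {s u w} → s ∈ S → E T s u ≡ true → E T s w ≡ true → w ≡ u
  unique-neighbour {s} s∈S esu esw =
    size-one-unique (tabulate (E T s)) (degS T s s∈S) (∈-tabulate⁺ (E T s) esu) (∈-tabulate⁺ (E T s) esw)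

  neighbour-outside : 3 ≤ ∣ S ∣ → ∀ {s u} → s ∈ S → E T s u ≡ true → u ∉ S
  neighbour-outside 3≤∣S∣ {s} {u} s∈S esu u∈S = ≤⇒≯ (⊆pair⇒∣∣≤2 S s u S⊆su) 3≤∣S∣
    where
    S⊆su : ∀ {x} → x ∈ S → x ≡ s ⊎ x ≡ u
    S⊆su x∈S = walk-confined (E T) s u
      (λ w → unique-neighbour s∈S esu)
      (λ w → unique-neighbour u∈S (trans (esym u s) esu))
      (connected s _ (SinW T s s∈S) (SinW T _ x∈S)) (inj₁ refl)

-- An edge set all of whose edges contain w has no cycle: of the three
-- distinct consecutive vertices x_{m+2}, x_0, x_1, x_2 of a cycle, the edges
-- x_0x_1, x_1x_2 and x_{m+2}x_0 cannot all contain w.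
centred⇒acyclic : ∀ {N} (E : EdgeSet N) w → (∀ {u v} → E u v ≡ true → u ≡ w ⊎ v ≡ w) → ¬ Cycle E
centred⇒acyclic E w centred c
  with centred (Cycle.edges c fzero) | centred (Cycle.edges c (fsuc fzero)) | centred (Cycle.close c)
... | inj₁ x₀≡w | inj₁ x₁≡w | _         with () ← Cycle.inj c (trans x₀≡w (sym x₁≡w))
... | inj₁ x₀≡w | inj₂ x₂≡w | _         with () ← Cycle.inj c (trans x₀≡w (sym x₂≡w))
... | inj₂ x₁≡w | _         | inj₁ xₗ≡w with () ← Cycle.inj c (trans x₁≡w (sym xₗ≡w))
... | inj₂ x₁≡w | _         | inj₂ x₀≡w with () ← Cycle.inj c (trans x₁≡w (sym x₀≡w))

module Star {N : ℕ} {Adj : Fin N → Fin N → Set} {S : Subset N} (w : Fin N) (w∉S : w ∉ S)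
            (adjacent : ∀ {s} → s ∈ S → Adj s w × Adj w s) where

  StarEdge : Fin N → Fin N → Set
  StarEdge u v = (u ∈ S × v ≡ w) ⊎ (v ∈ S × u ≡ w)

  star-edge? : ∀ u v → Dec (StarEdge u v)
  star-edge? u v = (u ∈? S ×-dec v ≟ w) ⊎-dec (v ∈? S ×-dec u ≟ w)

  edges : EdgeSet N
  edges u v = ⌊ star-edge? u v ⌋

  leaf-edge : ∀ {s} → s ∈ S → edges s w ≡ true
  leaf-edge {s} s∈S = ⌊⌋-complete (star-edge? s w) (inj₁ (s∈S , refl))

  centre-edge : ∀ {s} → s ∈ S → edges w s ≡ true
  centre-edge {s} s∈S = ⌊⌋-complete (star-edge? w s) (inj₂ (s∈S , refl))

  centred : ∀ {u v} → edges u v ≡ true → u ≡ w ⊎ v ≡ w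
  centred {u} {v} e with ⌊⌋-sound (star-edge? u v) e
  ... | inj₁ (_ , v≡w) = inj₂ v≡w
  ... | inj₂ (_ , u≡w) = inj₁ u≡w

  vertices : Subset N
  vertices = S ∪ ⁅ w ⁆

  centre∈ : w ∈ vertices
  centre∈ = x∈p∪q⁺ (inj₂ (x∈⁅x⁆ w))

  leaf∈ : ∀ {s} → s ∈ S → s ∈ vertices
  leaf∈ s∈S = x∈p∪q⁺ (inj₁ s∈S)

  to-centre : ∀ {u} → u ∈ vertices → Walk edges u w
  to-centre {u} u∈ with x∈p∪q⁻ S ⁅ w ⁆ u∈
  ... | inj₁ u∈S = step (leaf-edge u∈S) here
  ... | inj₂ u∈w with refl ← x∈⁅y⁆⇒x≡y w u∈w = here

  from-centre : ∀ {v} → v ∈ vertices → Walk edges w v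
  from-centre {v} v∈ with x∈p∪q⁻ S ⁅ w ⁆ v∈
  ... | inj₁ v∈S = step (centre-edge v∈S) here
  ... | inj₂ v∈w with refl ← x∈⁅y⁆⇒x≡y w v∈w = here

  in-G : ∀ u v → edges u v ≡ true → u ∈ vertices × v ∈ vertices × Adj u v
  in-G u v e with ⌊⌋-sound (star-edge? u v) e
  ... | inj₁ (u∈S , refl) = leaf∈ u∈S , centre∈ , proj₁ (adjacent u∈S)
  ... | inj₂ (v∈S , refl) = centre∈ , leaf∈ v∈S , proj₂ (adjacent v∈S)

  leaf-degree : ∀ s → s ∈ S → deg edges s ≡ 1
  leaf-degree s s∈S = only-member⇒size-one (tabulate (edges s)) w (∈-tabulate⁺ (edges s) (leaf-edge s∈S)) only-w
    where
    only-w : ∀ {v} → v ∈ tabulate (edges s) → v ≡ w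
    only-w {v} v∈ with ⌊⌋-sound (star-edge? s v) (∈-tabulate⁻ (edges s) v∈)
    ... | inj₁ (_ , v≡w) = v≡w
    ... | inj₂ (_ , s≡w) = contradiction (subst (_∈ S) s≡w s∈S) w∉S

  star : PedantSteinerTree Adj S
  star = record
    { W    = vertices
    ; E    = edges
    ; tree = record
      { esym      = λ u v → ⌊⌋-⇔ (mk⇔ swap swap) (star-edge? u v) (star-edge? v u)
      ; eInG      = in-G
      ; connected = λ u v u∈ v∈ → walk-++ (to-centre u∈) (from-centre v∈)
      ; acyclic   = centred⇒acyclic edges w centred }
    ; SinW = λ s → leaf∈
    ; degS = leaf-degree }

empty-family : ∀ {N} {Adj : Fin N → Fin N → Set} {S : Subset N} → DisjointFamily Adj S 0
empty-family = record { trees = λ () ; disjoint = λ () }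

single-family : ∀ {N} {Adj : Fin N → Fin N → Set} {S : Subset N} → PedantSteinerTree Adj S → DisjointFamily Adj S 1
single-family T = record { trees = λ _ → T ; disjoint = λ { fzero fzero 0≢0 → contradiction refl 0≢0 } }

record OuterPair {M N : ℕ} (X : Subset M) (π : Fin M → Fin N) (S W : Subset N) : Set where
  field
    point    : Fin 2 → Fin M
    distinct : point fzero ≢ point (fsuc fzero)
    point∈X  : ∀ c → point c ∈ X
    over-W   : ∀ c → π (point c) ∈ W
    over-∁S  : ∀ c → π (point c) ∉ S
open OuterPair

distinct⇒injective : ∀ {A : Set} (q : Fin 2 → A) → q fzero ≢ q (fsuc fzero) → Injective _≡_ _≡_ q
distinct⇒injective q q0≢q1 {fzero}      {fzero}      _  = refl
distinct⇒injective q q0≢q1 {fzero}      {fsuc fzero} eq = contradiction eq q0≢q1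
distinct⇒injective q q0≢q1 {fsuc fzero} {fzero}      eq = contradiction (sym eq) q0≢q1
distinct⇒injective q q0≢q1 {fsuc fzero} {fsuc fzero} _  = refl

remQuot-injective : ∀ {m} k {x y : Fin (m * k)} → remQuot {m} k x ≡ remQuot k y → x ≡ y
remQuot-injective {m} k {x} {y} eq =
  trans (sym (combine-remQuot {m} k x)) (trans (cong (uncurry combine) eq) (combine-remQuot {m} k y))

-- If each tree of a family of m internally disjoint S-Steiner trees has an
-- outer pair in X, then 2m ≤ |X|: pairs of different trees lie over the
-- disjoint sets W ∖ S, so all 2m points are distinct.
family-size : ∀ {M N m} {Adj : Fin N → Fin N → Set} {S : Subset N}
              (F : DisjointFamily Adj S m) (X : Subset M) (π : Fin M → Fin N) →
              (∀ i → OuterPair X π S (W (DisjointFamily.trees F i))) → m * 2 ≤ ∣ X ∣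
family-size {m = m} F X π pair =
  injection⇒≤∣∣ X (g ∘ remQuot 2) (remQuot-injective 2 ∘ g-inj) (λ x → point∈X (pair _) _)
  where
  open DisjointFamily F
  g : Fin m × Fin 2 → _
  g (i , c) = point (pair i) c
  g-inj : ∀ {x y} → g x ≡ g y → x ≡ y
  g-inj {i , c} {j , d} eq with i ≟ j
  ... | yes refl = cong (i ,_) (distinct⇒injective (point (pair i)) (distinct (pair i)) eq)
  ... | no  i≢j  = contradiction (proj₂ (disjoint i j i≢j) _ (over-W (pair i) c) over-Wj) (over-∁S (pair i) c)
    where
    over-Wj : π (point (pair i) c) ∈ W (trees j)
    over-Wj = subst (_∈ W (trees j)) (cong π (sym eq)) (over-W (pair j) d)

-- A point of Fin (N + N) is a vertex of Fin N in one of two copies.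
over : ∀ {N} → Fin (N + N) → Fin N
over {N} x = [ id , id ]′ (splitAt N x)

over-↑ˡ : ∀ {N} (a : Fin N) → over (a ↑ˡ N) ≡ a
over-↑ˡ {N} a = cong [ id , id ]′ (splitAt-↑ˡ N a N)

over-↑ʳ : ∀ {N} (a : Fin N) → over (N ↑ʳ a) ≡ a
over-↑ʳ {N} a = cong [ id , id ]′ (splitAt-↑ʳ N N a)

↑ˡ≢↑ʳ : ∀ {N} (a b : Fin N) → a ↑ˡ N ≢ N ↑ʳ b
↑ˡ≢↑ʳ {N} a b eq with () ← trans (sym (splitAt-↑ˡ N a N)) (trans (cong (splitAt N) eq) (splitAt-↑ʳ N N b))

-- Points are taken in
-- (∁ S) ++ L: the neighbour a of some terminal lies outside S; if a ∈ L we
-- take both copies of a, otherwise a terminal s' in the part of a has a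
-- neighbour b ∉ S in another part, and we take a and b.
module TreeCount {N t : ℕ} (p : Fin N → Fin t) {S : Subset N} (3≤∣S∣ : 3 ≤ ∣ S ∣) (L : Subset N)
                 (covered : ∀ v → v ∉ L → Σ (Fin N) λ s → s ∈ S × p s ≡ p v) where

  points : Subset (N + N)
  points = ∁ S ++ L

  module _ (T : PedantSteinerTree (KAdj p) S) where
    open PedantTree T
    open IsTree (tree T)

    Admissible : Fin (N + N) → Set
    Admissible x = x ∈ points × over x ∈ W T × over x ∉ S

    pair-of : ∀ x y → x ≢ y → Admissible x → Admissible y → OuterPair points over S (W T)
    pair-of x y x≢y (x∈ , x-W , x-∁S) (y∈ , y-W , y-∁S) = record
      { point    = λ { fzero → x ; (fsuc _) → y }
      ; distinct = x≢y
      ; point∈X  = λ { fzero → x∈   ; (fsuc fzero) → y∈ }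
      ; over-W   = λ { fzero → x-W  ; (fsuc fzero) → y-W }
      ; over-∁S  = λ { fzero → x-∁S ; (fsuc fzero) → y-∁S } }

    left-copy : ∀ {a} → a ∉ S → a ∈ W T → Admissible (a ↑ˡ N)
    left-copy {a} a∉S a∈W =
      ∈-++ˡ L (x∉p⇒x∈∁p a∉S) , subst (_∈ W T) (sym (over-↑ˡ a)) a∈W , subst (_∉ S) (sym (over-↑ˡ a)) a∉S

    right-copy : ∀ {a} → a ∈ L → a ∉ S → a ∈ W T → Admissible (N ↑ʳ a)
    right-copy {a} a∈L a∉S a∈W =
      ∈-++ʳ (∁ S) a∈L , subst (_∈ W T) (sym (over-↑ʳ a)) a∈W , subst (_∉ S) (sym (over-↑ʳ a)) a∉S

    outer-pair : OuterPair points over S (W T)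
    outer-pair with member S (≤-trans (s≤s z≤n) 3≤∣S∣)
    ... | s , s∈S with neighbour s∈S
    ... | a , esa with neighbour-outside 3≤∣S∣ s∈S esa | proj₁ (proj₂ (eInG s a esa)) | a ∈? L
    ... | a∉S | a∈W | yes a∈L = pair-of _ _ (↑ˡ≢↑ʳ a a) (left-copy a∉S a∈W) (right-copy a∈L a∉S a∈W)
    ... | a∉S | a∈W | no  a∉L with covered a a∉L
    ...   | s′ , s′∈S , ps′≡pa with neighbour s′∈S
    ...     | b , es′b with eInG s′ b es′b
    ...       | _ , b∈W , ps′≢pb = pair-of _ _ a≢b (left-copy a∉S a∈W) (left-copy (neighbour-outside 3≤∣S∣ s′∈S es′b) b∈W)
      where
      a≢b : a ↑ˡ N ≢ b ↑ˡ N
      a≢b eq = ps′≢pb (trans ps′≡pa (cong p (↑ˡ-injective N a b eq)))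

  tree-count : ∀ {m} → DisjointFamily (KAdj p) S m → m * 2 ≤ (N ∸ ∣ S ∣) + ∣ L ∣
  tree-count F = subst (_ ≤_) ∣points∣ (family-size F points over (λ i → outer-pair (DisjointFamily.trees F i)))
    where
    ∣points∣ : ∣ points ∣ ≡ (N ∸ ∣ S ∣) + ∣ L ∣
    ∣points∣ = trans (∣p++q∣ (∁ S) L) (cong (_+ ∣ L ∣) (∣∁p∣≡n∸∣p∣ S))

-- Classically the largest size of a family exists; constructively we get it
-- up to double negation, which is enough for the decidable conclusion m ≤ b.
largest-exists : (P : ℕ → Set) → P 0 → ∀ b → (∀ j → P j → j ≤ b) →
                 ¬ ¬ (Σ ℕ λ m → P m × (∀ j → P j → j ≤ m))
largest-exists P P0 zero    bounded ¬largest = ¬largest (0 , P0 , bounded)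
largest-exists P P0 (suc b) bounded ¬largest = ¬¬-excluded-middle λ
  { (yes Pb) → ¬largest (suc b , Pb , bounded)
  ; (no ¬Pb) → largest-exists P P0 b (λ j Pj → m<1+n⇒m≤n (≤∧≢⇒< (bounded j Pj) (λ { refl → ¬Pb Pj }))) ¬largest }

record HardSet {N : ℕ} (Adj : Fin N → Fin N → Set) (k b : ℕ) : Set where
  field
    terminals : Subset N
    size      : ∣ terminals ∣ ≡ k
    bounded   : ∀ m → DisjointFamily Adj terminals m → m ≤ b

τk-upper : ∀ {N} {Adj : Fin N → Fin N → Set} {k b} → HardSet Adj k b → ∀ m → IsTauK Adj k m → m ≤ b
τk-upper {Adj = Adj} {b = b} H m (_ , minimal) = decidable-stable (m ≤? b) λ m≰b →
  largest-exists (DisjointFamily Adj terminals) empty-family b bounded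
    λ { (m′ , F , maximal) → m≰b (≤-trans (minimal terminals size m′ (F , maximal)) (bounded m′ F)) }
  where open HardSet H

τk-exact : ∀ {N} {Adj : Fin N → Fin N → Set} {k b} → HardSet Adj k b →
           (∀ S → ∣ S ∣ ≡ k → DisjointFamily Adj S b) → IsTauK Adj k b
τk-exact {b = b} H everywhere =
  (terminals , size , everywhere terminals size , bounded) ,
  λ S ∣S∣≡k m′ τ′ → proj₂ τ′ b (everywhere S ∣S∣≡k)
  where open HardSet H

module CompleteMultipartite {N t : ℕ} {ns : Fin t → ℕ} {p : Fin N → Fin t}
                            (G : IsCompleteMultipartite N t ns p) where
  open IsCompleteMultipartite G

  representative : ∀ i → Σ (Fin N) λ v → p v ≡ i
  representative i with member (tabulate (λ v → ⌊ p v ≟ i ⌋)) (subst (1 ≤_) (sym (partSize i)) (nonempty i))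
  ... | v , v∈ = v , ⌊⌋-sound (p v ≟ i) (∈-tabulate⁻ _ v∈)

  rep : Fin t → Fin N
  rep i = proj₁ (representative i)

  rep-part : ∀ i → p (rep i) ≡ i
  rep-part i = proj₂ (representative i)

  rep-injective : Injective _≡_ _≡_ rep
  rep-injective {i} {j} eq = trans (sym (rep-part i)) (trans (cong p eq) (rep-part j))

  count-by-parts : ∀ Q → ∣ tabulate (Q ∘ p) ∣ ≡ ∑ (λ i → if Q i then ns i else 0)
  count-by-parts Q = trans (fibre-decomposition p Q) (∑-cong λ i → cong (if Q i then_else 0) (partSize i))

  vertex-count : N ≡ sumFrom ns 0
  vertex-count = trans (sym (∣all∣ N)) (count-by-parts (λ _ → true))

  hard-set₁ : ∀ k → 3 ≤ k → k ≤ N → t ≤ k → HardSet (KAdj p) k (bound1 ns k)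
  hard-set₁ k 3≤k k≤N t≤k with extend (image rep) k (≤-trans (∣image∣≤ rep) t≤k) k≤N
  ... | S , reps⊆S , ∣S∣≡k = record { terminals = S ; size = ∣S∣≡k ; bounded = bounded }
    where
    covered : ∀ v → v ∉ ⊥ → Σ (Fin N) λ s → s ∈ S × p s ≡ p v
    covered v _ = rep (p v) , reps⊆S (∈-image rep (p v)) , rep-part (p v)

    count : (N ∸ ∣ S ∣) + ∣ ⊥ {n = N} ∣ ≡ sumFrom ns 0 ∸ k
    count = trans (cong₂ _+_ (cong₂ _∸_ vertex-count ∣S∣≡k) (∣⊥∣≡0 N)) (+-identityʳ _)

    bounded : ∀ m → DisjointFamily (KAdj p) S m → m ≤ bound1 ns k
    bounded m F = half m _ (subst (m * 2 ≤_) count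
      (TreeCount.tree-count p (subst (3 ≤_) (sym ∣S∣≡k) 3≤k) ⊥ covered F))

  hard-set₂ : ∀ k → 3 ≤ k → k < t → HardSet (KAdj p) k (bound2 ns k)
  hard-set₂ k 3≤k k<t = record { terminals = S ; size = ∣S∣≡k ; bounded = bounded }
    where
    U B : ℕ
    U = sumUpTo ns k
    B = sumFrom ns k

    first : Fin k → Fin t
    first j = inject≤ j (<⇒≤ k<t)

    terminal : Fin k → Fin N
    terminal = rep ∘ first

    terminal-injective : Injective _≡_ _≡_ terminal
    terminal-injective = inject≤-injective _ _ _ _ ∘ rep-injective

    S : Subset N
    S = image terminal

    ∣S∣≡k : ∣ S ∣ ≡ k
    ∣S∣≡k = ≤-antisym (∣image∣≤ terminal) (injection⇒≤∣∣ S terminal terminal-injective (∈-image terminal))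

    small : Fin N → Bool
    small v = toℕ (p v) <ᵇ k

    ∣small∣ : ∣ tabulate small ∣ ≡ U
    ∣small∣ = count-by-parts (λ i → toℕ i <ᵇ k)

    toℕ-part-terminal : ∀ j → toℕ (p (terminal j)) ≡ toℕ j
    toℕ-part-terminal j = trans (cong toℕ (rep-part (first j))) (toℕ-inject≤ j _)

    k≤U : k ≤ U
    k≤U = subst (k ≤_) ∣small∣ (injection⇒≤∣∣ (tabulate small) terminal terminal-injective
      (λ j → ∈-tabulate⁺ small (<⇒<ᵇ-true (subst (_< k) (sym (toℕ-part-terminal j)) (toℕ<n j)))))

    covered : ∀ v → v ∉ ∁ (tabulate small) → Σ (Fin N) λ s → s ∈ S × p s ≡ p v
    covered v v∉ = terminal j , ∈-image terminal j ,
                   toℕ-injective (trans (toℕ-part-terminal j) (toℕ-fromℕ< p<k))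
      where
      p<k : toℕ (p v) < k
      p<k = <ᵇ-true⇒< _ _ (∈-tabulate⁻ small (x∉∁p⇒x∈p v∉))
      j : Fin k
      j = fromℕ< p<k

    N≡U+B : N ≡ U + B
    N≡U+B = trans vertex-count (sym (∑-split ns k))

    count : (N ∸ ∣ S ∣) + ∣ ∁ (tabulate small) ∣ ≡ B * 2 + (U ∸ k)
    count = begin
      (N ∸ ∣ S ∣) + ∣ ∁ (tabulate small) ∣   ≡⟨ cong₂ _+_ (cong (N ∸_) ∣S∣≡k) (trans (∣∁p∣≡n∸∣p∣ (tabulate small)) (cong (N ∸_) ∣small∣)) ⟩
      (N ∸ k) + (N ∸ U)                      ≡⟨ cong (λ n → (n ∸ k) + (n ∸ U)) N≡U+B ⟩
      (U + B ∸ k) + (U + B ∸ U)              ≡⟨ cong₂ _+_ (+-∸-comm B k≤U) (m+n∸m≡n U B) ⟩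
      (U ∸ k) + B + B                        ≡⟨ +-twice (U ∸ k) B ⟩
      B * 2 + (U ∸ k)                        ∎
      where open ≡-Reasoning

    halve : (B * 2 + (U ∸ k)) / 2 ≡ bound2 ns k
    halve = trans (+-distrib-/-∣ˡ (U ∸ k) (divides-refl B)) (cong (_+ (U ∸ k) / 2) (m*n/n≡m B 2))

    bounded : ∀ m → DisjointFamily (KAdj p) S m → m ≤ bound2 ns k
    bounded m F = subst (m ≤_) halve (half m _ (subst (m * 2 ≤_) count
      (TreeCount.tree-count p (subst (3 ≤_) (sym ∣S∣≡k) 3≤k) (∁ (tabulate small)) covered F)))

complete-graph : ∀ N → IsCompleteMultipartite N N (λ _ → 1) id
complete-graph N = record
  { partSize = λ i → only-member⇒size-one _ i (∈-tabulate⁺ _ (⌊⌋-complete (i ≟ i) refl))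
                                              (λ {v} v∈ → ⌊⌋-sound (v ≟ i) (∈-tabulate⁻ _ v∈))
  ; nonempty = λ _ → ≤-refl
  ; sorted   = λ _ _ _ → ≤-refl }

complete-graph-star : ∀ {N} (S : Subset N) → ∣ S ∣ < N → PedantSteinerTree (KAdj (id {A = Fin N})) S
complete-graph-star {N} S ∣S∣<N with member (∁ S) (subst (1 ≤_) (sym (∣∁p∣≡n∸∣p∣ S)) (m<n⇒0<n∸m ∣S∣<N))
... | w , w∈∁S = Star.star w w∉S (λ s∈S → s≢w s∈S , (s≢w s∈S ∘ sym))
  where
  w∉S : w ∉ S
  w∉S = x∈∁p⇒x∉p w∈∁S
  s≢w : ∀ {s} → s ∈ S → s ≢ w
  s≢w s∈S s≡w = w∉S (subst (_∈ S) s≡w s∈S)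

open CompleteMultipartite using (hard-set₁; hard-set₂)

sharp₁ : IsTauK (KAdj (id {A = Fin 3})) 3 (bound1 (λ (_ : Fin 3) → 1) 3)
sharp₁ = τk-exact (hard-set₁ (complete-graph 3) 3 ≤-refl ≤-refl ≤-refl) (λ _ _ → empty-family)

-- Sharpness of (2): τ_3(K_{1,1,1,1}) = 1 = n_4 + ⌊(3 - 3)/2⌋, since every
-- 3-set of terminals is the leaf set of a star.
sharp₂ : IsTauK (KAdj (id {A = Fin 4})) 3 (bound2 (λ (_ : Fin 4) → 1) 3)
sharp₂ = τk-exact (hard-set₂ (complete-graph 4) 3 ≤-refl ≤-refl)
  (λ S ∣S∣≡3 → single-family (complete-graph-star S (subst (_< 4) (sym ∣S∣≡3) ≤-refl)))

theorem2 : (∀ (N t : ℕ) (ns : Fin t → ℕ) (p : Fin N → Fin t) (k : ℕ) →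
    IsCompleteMultipartite N t ns p → 3 ≤ k → k ≤ N →
    (t ≤ k → ∀ m → IsTauK (KAdj p) k m → m ≤ bound1 ns k) ×
    (k < t → ∀ m → IsTauK (KAdj p) k m → m ≤ bound2 ns k))
    ×
    (Σ ℕ λ N → Σ ℕ λ t → Σ (Fin t → ℕ) λ ns → Σ (Fin N → Fin t) λ p → Σ ℕ λ k →
    IsCompleteMultipartite N t ns p × 3 ≤ k × k ≤ N × t ≤ k ×
    IsTauK (KAdj p) k (bound1 ns k))
    ×
    (Σ ℕ λ N → Σ ℕ λ t → Σ (Fin t → ℕ) λ ns → Σ (Fin N → Fin t) λ p → Σ ℕ λ k →
    IsCompleteMultipartite N t ns p × 3 ≤ k × k ≤ N × k < t ×
    IsTauK (KAdj p) k (bound2 ns k))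
theorem2 =
  (λ N t ns p k G 3≤k k≤N →
     (λ t≤k → τk-upper (hard-set₁ G k 3≤k k≤N t≤k)) ,
     (λ k<t → τk-upper (hard-set₂ G k 3≤k k<t))) ,
  (3 , 3 , (λ _ → 1) , id , 3 , complete-graph 3 , ≤-refl , ≤-refl , ≤-refl , sharp₁) ,
  (4 , 4 , (λ _ → 1) , id , 3 , complete-graph 4 , ≤-refl , n≤1+n 3 , ≤-refl , sharp₂)
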